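{- Let $q>0$ with $q\neq 1$ and let $r$ be a real number. Let $S(n,k,r)$ be defined by $S(0,k,r)=[k=0]$ for $k\ge 0$, $S(n,0,r)=[r]^n$ for $n\ge 0$, and $S(n,k,r)=S(n-1,k-1,r)+[k+r]\,S(n-1,k,r)$ for $n,k\ge 1$. Then for all integers $0\le k\le n$, $$(q-1)^{n-k}\,q^{rk}\,S(n,k,r)=\sum_{i=0}^n(-1)^{n-i}\,q^{ri}\binom{n}{i}\begin{bmatrix} i\\ k\end{bmatrix}.$$
   Context: Notation: $[t]=\frac{1-q^t}{1-q}$ for real $t$; $[n]!=[1][2]\cdots[n]$ for integers $n\ge 0$ (with $[0]!=1$); $\begin{bmatrix} i\\ k\end{bmatrix}=\frac{[i]!}{[k]![i-k]!}$ for integers $0\le k\le i$ and $0$ otherwise; $\binom{n}{i}$ is the ordinary binomial coefficient; $[P]$ for a statement $P$ is $1$ if $P$ holds and $0$ otherwise. -}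

module Defs where

open import Algebra.Bundles using (CommutativeRing)
open import Data.Nat using (ℕ; zero; suc)

-- All notions, stated over an arbitrary commutative ring R.
--   q   : the parameter q
--   u   : the inverse of (1 - q)   (exists since q ≠ 1 in the real field)
--   x   : the quantity q^r
module QDefs {c ℓ} (R : CommutativeRing c ℓ) where
  open CommutativeRing R hiding (zero)

  pow : Carrier → ℕ → Carrier
  pow a zero    = 1#
  pow a (suc n) = a * pow a n

  natC : ℕ → Carrier
  natC zero    = 0#
  natC (suc n) = 1# + natC n

  sgn : ℕ → Carrier
  sgn zero    = 1#
  sgn (suc n) = - sgn n

  Σ : ℕ → (ℕ → Carrier) → Carrier
  Σ zero    f = f zero
  Σ (suc n) f = Σ n f + f (suc n)

  -- [k + r] = (1 - q^(k+r)) / (1 - q) = (1 - q^k · x) · u   where x = q^r, u = (1-q)^{-1}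
  qshift : (q u x : Carrier) → ℕ → Carrier
  qshift q u x k = (1# - pow q k * x) * u

  qbin : Carrier → ℕ → ℕ → Carrier
  qbin q zero    zero    = 1#
  qbin q zero    (suc k) = 0#
  qbin q (suc i) zero    = 1#
  qbin q (suc i) (suc k) = qbin q i k + pow q (suc k) * qbin q i (suc k)

  S : (q u x : Carrier) → ℕ → ℕ → Carrier
  S q u x zero    zero    = 1#
  S q u x zero    (suc k) = 0#
  S q u x (suc n) zero    = pow (qshift q u x 0) (suc n)
  S q u x (suc n) (suc k) = S q u x n k + qshift q u x (suc k) * S q u x n (suc k)

{-# OPTIONS --safe #-}
-- Write x = q^r. Both sides obey the recurrence F(0,k) = [k = 0], F(n+1,0) = (x - 1) F(n,0),
-- F(n+1,k+1) = x F(n,k) + (q^(k+1) x - 1) F(n,k+1), so they agree. For the left side this is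
-- the recurrence of S multiplied through by (q - 1)^(n-k) x^k, using (q - 1)[k + r] = q^(k+r) - 1.
-- The right side is the n-th forward difference Δ at 0 of g_k(i) = x^i [i choose k]_q; the rule
-- Δ^(n+1) g = Δ^n (g ∘ suc) - Δ^n g turns the q-Pascal recurrence
-- g_(k+1)(i+1) = x g_k(i) + q^(k+1) x g_(k+1)(i) into the same recurrence.
module Submission where

open import Defs
open import Algebra.Bundles using (CommutativeRing)
open import Data.Nat as ℕ using (ℕ; zero; suc; _≤_; _<_; _∸_; s≤s)
open import Data.Nat.Combinatorics using (_C_; k>n⇒nCk≡0; nCk+nC[k+1]≡[n+1]C[k+1])
open import Data.Nat.Properties using (+-∸-assoc; _<?_; ≮⇒≥; n<1+n; m<n⇒m<1+n)
open import Level using (_⊔_)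
open import Relation.Binary.PropositionalEquality as ≡ using (_≡_; cong)
open import Relation.Nullary using (yes; no)
import Algebra.Properties.Ring as RingProperties
import Algebra.Properties.CommutativeSemigroup as CommutativeSemigroupProperties
import Algebra.Solver.CommutativeMonoid as CommutativeMonoidSolver

∸-suc : ∀ {j n} → j < n → n ∸ j ≡ suc (n ∸ suc j)
∸-suc = +-∸-assoc 1

module QStirling {c ℓ} (R : CommutativeRing c ℓ) where
  open CommutativeRing R hiding (zero)
  open QDefs R
  open RingProperties ring
    using (-‿distribˡ-*; -‿+-comm; -0#≈0#; ⁻¹-anti-homo‿-; [y-z]x≈yx-zx; -1*x≈-x)
  open CommutativeSemigroupProperties +-commutativeSemigroup using ()
    renaming (interchange to +-interchange; x∙yz≈y∙xz to +-left-comm)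
  open CommutativeSemigroupProperties *-commutativeSemigroup using ()
    renaming (interchange to *-interchange; x∙yz≈y∙xz to *-left-comm; xy∙z≈xz∙y to *-right-comm)
  open import Relation.Binary.Reasoning.Setoid setoid

  [x-1]y≈xy-y : ∀ a b → (a - 1#) * b ≈ a * b - b
  [x-1]y≈xy-y a b = trans ([y-z]x≈yx-zx b a 1#) (+-congˡ (-‿cong (*-identityˡ b)))

  natC-+ : ∀ m n → natC (m ℕ.+ n) ≈ natC m + natC n
  natC-+ zero    n = sym (+-identityˡ _)
  natC-+ (suc m) n = trans (+-congˡ (natC-+ m n)) (sym (+-assoc _ _ _))

  Σ-cong : ∀ n {f g : ℕ → Carrier} → (∀ i → f i ≈ g i) → Σ n f ≈ Σ n g
  Σ-cong zero    f≈g = f≈g zero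
  Σ-cong (suc n) f≈g = +-cong (Σ-cong n f≈g) (f≈g (suc n))

  Σ-distrib-+ : ∀ n (f g : ℕ → Carrier) → Σ n (λ i → f i + g i) ≈ Σ n f + Σ n g
  Σ-distrib-+ zero    f g = refl
  Σ-distrib-+ (suc n) f g = trans (+-congʳ (Σ-distrib-+ n f g)) (+-interchange _ _ _ _)

  Σ-*ˡ : ∀ n a (f : ℕ → Carrier) → Σ n (λ i → a * f i) ≈ a * Σ n f
  Σ-*ˡ zero    a f = refl
  Σ-*ˡ (suc n) a f = trans (+-congʳ (Σ-*ˡ n a f)) (sym (distribˡ a _ _))

  Σ-neg : ∀ n (f : ℕ → Carrier) → Σ n (λ i → - f i) ≈ - Σ n f
  Σ-neg zero    f = refl
  Σ-neg (suc n) f = trans (+-congʳ (Σ-neg n f)) (-‿+-comm _ _)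

  Σ-unfoldˡ : ∀ n (f : ℕ → Carrier) → Σ (suc n) f ≈ f 0 + Σ n (λ i → f (suc i))
  Σ-unfoldˡ zero    f = refl
  Σ-unfoldˡ (suc n) f = trans (+-congʳ (Σ-unfoldˡ n f)) (+-assoc _ _ _)

  alternatingBinomial : ℕ → ℕ → Carrier
  alternatingBinomial n i = sgn (n ∸ i) * natC (n C i)

  *-natC-C-vanishes : ∀ a {n i} → n < i → a * natC (n C i) ≈ 0#
  *-natC-C-vanishes a n<i = trans (*-congˡ (reflexive (cong natC (k>n⇒nCk≡0 n<i)))) (zeroʳ a)

  alternatingBinomial-suc-zero : ∀ n → alternatingBinomial (suc n) 0 ≈ - alternatingBinomial n 0
  alternatingBinomial-suc-zero n = sym (-‿distribˡ-* _ _)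

  sgn-∸-shift : ∀ n j → sgn (n ∸ j) * natC (n C suc j) ≈ - alternatingBinomial n (suc j)
  sgn-∸-shift n j with j <? n
  ... | yes j<n rewrite ∸-suc j<n = sym (-‿distribˡ-* _ _)
  ... | no  j≮n = trans (vanishes _) (sym (trans (-‿cong (vanishes _)) -0#≈0#))
    where
    vanishes : ∀ a → a * natC (n C suc j) ≈ 0#
    vanishes a = *-natC-C-vanishes a (s≤s (≮⇒≥ j≮n))

  alternatingBinomial-pascal : ∀ n j →
    alternatingBinomial (suc n) (suc j) ≈ alternatingBinomial n j - alternatingBinomial n (suc j)
  alternatingBinomial-pascal n j = begin
    sgn (n ∸ j) * natC (suc n C suc j)
      ≈⟨ *-congˡ (reflexive (cong natC (nCk+nC[k+1]≡[n+1]C[k+1] n j))) ⟨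
    sgn (n ∸ j) * natC (n C j ℕ.+ n C suc j)
      ≈⟨ *-congˡ (natC-+ (n C j) (n C suc j)) ⟩
    sgn (n ∸ j) * (natC (n C j) + natC (n C suc j))
      ≈⟨ distribˡ _ _ _ ⟩
    alternatingBinomial n j + sgn (n ∸ j) * natC (n C suc j)
      ≈⟨ +-congˡ (sgn-∸-shift n j) ⟩
    alternatingBinomial n j - alternatingBinomial n (suc j) ∎

  Δ : ℕ → (ℕ → Carrier) → Carrier
  Δ n g = Σ n (λ i → alternatingBinomial n i * g i)

  Δ-cong : ∀ n {f g : ℕ → Carrier} → (∀ i → f i ≈ g i) → Δ n f ≈ Δ n g
  Δ-cong n f≈g = Σ-cong n (λ i → *-congˡ (f≈g i))

  Δ-+ : ∀ n (f g : ℕ → Carrier) → Δ n (λ i → f i + g i) ≈ Δ n f + Δ n g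
  Δ-+ n f g = trans (Σ-cong n (λ i → distribˡ _ _ _)) (Σ-distrib-+ n _ _)

  Δ-*ˡ : ∀ n a (f : ℕ → Carrier) → Δ n (λ i → a * f i) ≈ a * Δ n f
  Δ-*ˡ n a f = trans (Σ-cong n (λ i → *-left-comm _ a _)) (Σ-*ˡ n a _)

  Δ-suc : ∀ n (g : ℕ → Carrier) → Δ (suc n) g ≈ Δ n (λ i → g (suc i)) - Δ n g
  Δ-suc n g = begin
    Δ (suc n) g
      ≈⟨ Σ-unfoldˡ n _ ⟩
    alternatingBinomial (suc n) 0 * g 0 + Σ n (λ j → alternatingBinomial (suc n) (suc j) * g (suc j))
      ≈⟨ +-cong (*-congʳ (alternatingBinomial-suc-zero n))
                (Σ-cong n (λ j → trans (*-congʳ (alternatingBinomial-pascal n j))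
                                       ([y-z]x≈yx-zx _ _ _))) ⟩
    - w 0 * g 0 + Σ n (λ j → alternatingBinomial n j * g (suc j) - term (suc j))
      ≈⟨ +-cong (sym (-‿distribˡ-* _ _)) (trans (Σ-distrib-+ n _ _) (+-congˡ (Σ-neg n _))) ⟩
    - term 0 + (Δ n (λ i → g (suc i)) - Σ n (λ j → term (suc j)))
      ≈⟨ +-left-comm _ _ _ ⟩
    Δ n (λ i → g (suc i)) + (- term 0 - Σ n (λ j → term (suc j)))
      ≈⟨ +-congˡ (-‿+-comm _ _) ⟩
    Δ n (λ i → g (suc i)) - (term 0 + Σ n (λ j → term (suc j)))
      ≈⟨ +-congˡ (-‿cong (Σ-unfoldˡ n term)) ⟨
    Δ n (λ i → g (suc i)) - Σ (suc n) term
      ≈⟨ +-congˡ (-‿cong (trans (+-congˡ last-term-vanishes) (+-identityʳ _))) ⟩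
    Δ n (λ i → g (suc i)) - Δ n g ∎
    where
    w term : ℕ → Carrier
    w = alternatingBinomial n
    term i = w i * g i
    last-term-vanishes : term (suc n) ≈ 0#
    last-term-vanishes = trans (*-congʳ (*-natC-C-vanishes _ (n<1+n n))) (zeroˡ _)

  record SatisfiesRecurrence (q x : Carrier) (F : ℕ → ℕ → Carrier) : Set (c ⊔ ℓ) where
    field
      initial-zero : F 0 0 ≈ 1#
      initial-suc  : ∀ k → F 0 (suc k) ≈ 0#
      step-zero    : ∀ n → F (suc n) 0 ≈ (x - 1#) * F n 0
      step-suc     : ∀ n k → F (suc n) (suc k) ≈ x * F n k + (pow q (suc k) * x - 1#) * F n (suc k)

  recurrence-unique : ∀ {q x F G} → SatisfiesRecurrence q x F → SatisfiesRecurrence q x G →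
                      ∀ n k → F n k ≈ G n k
  recurrence-unique {F = F} {G = G} F-rec G-rec = go
    where
    module F = SatisfiesRecurrence F-rec
    module G = SatisfiesRecurrence G-rec
    go : ∀ n k → F n k ≈ G n k
    go zero    zero    = trans F.initial-zero (sym G.initial-zero)
    go zero    (suc k) = trans (F.initial-suc k) (sym (G.initial-suc k))
    go (suc n) zero    = trans (F.step-zero n) (trans (*-congˡ (go n 0)) (sym (G.step-zero n)))
    go (suc n) (suc k) =
      trans (F.step-suc n k)
        (trans (+-cong (*-congˡ (go n k)) (*-congˡ (go n (suc k)))) (sym (G.step-suc n k)))

  module RightHandSide (q x : Carrier) where

    qbin-zero : ∀ i → qbin q i 0 ≡ 1#
    qbin-zero zero    = ≡.refl
    qbin-zero (suc i) = ≡.refl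

    xqbin : ℕ → ℕ → Carrier
    xqbin k i = pow x i * qbin q i k

    xqbin-zero-suc : ∀ i → xqbin 0 (suc i) ≈ x * xqbin 0 i
    xqbin-zero-suc i = trans (*-assoc _ _ _) (*-congˡ (*-congˡ (reflexive (≡.sym (qbin-zero i)))))

    xqbin-suc-suc : ∀ k i →
      xqbin (suc k) (suc i) ≈ x * xqbin k i + (pow q (suc k) * x) * xqbin (suc k) i
    xqbin-suc-suc k i = trans (distribˡ _ _ _)
      (+-cong (*-assoc _ _ _) (trans (*-interchange _ _ _ _) (*-congʳ (*-comm x _))))

    rhs : ℕ → ℕ → Carrier
    rhs n k = Σ n (λ i → sgn (n ∸ i) * pow x i * natC (n C i) * qbin q i k)

    rhs≈Δ : ∀ n k → rhs n k ≈ Δ n (xqbin k)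
    rhs≈Δ n k = Σ-cong n (λ i → trans (*-congʳ (*-right-comm _ _ _)) (*-assoc _ _ _))

    rhs-satisfies : SatisfiesRecurrence q x rhs
    rhs-satisfies = record
      { initial-zero = trans (*-identityʳ _)
                         (trans (*-congʳ (*-identityʳ 1#)) (trans (*-identityˡ _) (+-identityʳ 1#)))
      ; initial-suc  = λ k → zeroʳ _
      ; step-zero    = step-zero
      ; step-suc     = step-suc
      }
      where
      step-zero : ∀ n → rhs (suc n) 0 ≈ (x - 1#) * rhs n 0
      step-zero n = begin
        rhs (suc n) 0                                ≈⟨ rhs≈Δ (suc n) 0 ⟩
        Δ (suc n) (xqbin 0)                          ≈⟨ Δ-suc n (xqbin 0) ⟩
        Δ n (λ i → xqbin 0 (suc i)) - Δ n (xqbin 0)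
          ≈⟨ +-congʳ (trans (Δ-cong n xqbin-zero-suc) (Δ-*ˡ n x _)) ⟩
        x * Δ n (xqbin 0) - Δ n (xqbin 0)            ≈⟨ [x-1]y≈xy-y x _ ⟨
        (x - 1#) * Δ n (xqbin 0)                     ≈⟨ *-congˡ (rhs≈Δ n 0) ⟨
        (x - 1#) * rhs n 0                           ∎

      step-suc : ∀ n k → rhs (suc n) (suc k) ≈ x * rhs n k + (pow q (suc k) * x - 1#) * rhs n (suc k)
      step-suc n k = begin
        rhs (suc n) (suc k)                                   ≈⟨ rhs≈Δ (suc n) (suc k) ⟩
        Δ (suc n) (xqbin (suc k))                             ≈⟨ Δ-suc n (xqbin (suc k)) ⟩
        Δ n (λ i → xqbin (suc k) (suc i)) - Δ n (xqbin (suc k))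
          ≈⟨ +-congʳ (trans (Δ-cong n (xqbin-suc-suc k))
                            (trans (Δ-+ n _ _) (+-cong (Δ-*ˡ n x _) (Δ-*ˡ n Q _)))) ⟩
        (x * Δ n (xqbin k) + Q * Δ n (xqbin (suc k))) - Δ n (xqbin (suc k))
          ≈⟨ +-assoc _ _ _ ⟩
        x * Δ n (xqbin k) + (Q * Δ n (xqbin (suc k)) - Δ n (xqbin (suc k)))
          ≈⟨ +-congˡ ([x-1]y≈xy-y Q _) ⟨
        x * Δ n (xqbin k) + (Q - 1#) * Δ n (xqbin (suc k))
          ≈⟨ +-cong (*-congˡ (rhs≈Δ n k)) (*-congˡ (rhs≈Δ n (suc k))) ⟨
        x * rhs n k + (Q - 1#) * rhs n (suc k)                ∎
        where
        Q : Carrier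
        Q = pow q (suc k) * x

  S-vanishes : ∀ q u x {n k} → n < k → S q u x n k ≈ 0#
  S-vanishes q u x {zero}  {suc k} _         = refl
  S-vanishes q u x {suc n} {suc k} (s≤s n<k) =
    trans (+-cong (S-vanishes q u x n<k) (trans (*-congˡ (S-vanishes q u x (m<n⇒m<1+n n<k))) (zeroʳ _)))
          (+-identityʳ 0#)

  S-zero-column : ∀ q u x n → S q u x n 0 ≡ pow (qshift q u x 0) n
  S-zero-column q u x zero    = ≡.refl
  S-zero-column q u x (suc n) = ≡.refl

  -- For n ≤ k the truncated n ∸ k is 0 and no factor a can be split off, but then S(n,k+1) = 0.
  pow-∸-*-S : ∀ q u x a n k →
    pow a (n ∸ k) * S q u x n (suc k) ≈ a * (pow a (n ∸ suc k) * S q u x n (suc k))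
  pow-∸-*-S q u x a n k with k <? n
  ... | yes k<n rewrite ∸-suc k<n = *-assoc _ _ _
  ... | no  k≮n = trans (vanishes _) (sym (trans (*-congˡ (vanishes _)) (zeroʳ a)))
    where
    vanishes : ∀ b → b * S q u x n (suc k) ≈ 0#
    vanishes b = trans (*-congˡ (S-vanishes q u x (s≤s (≮⇒≥ k≮n)))) (zeroʳ b)

  module LeftHandSide (q u x : Carrier) (u-inverse : (1# - q) * u ≈ 1#) where

    [q-1]*qshift : ∀ k → (q - 1#) * qshift q u x k ≈ pow q k * x - 1#
    [q-1]*qshift k = begin
      (q - 1#) * ((1# - a) * u)        ≈⟨ *-left-comm _ _ _ ⟩
      (1# - a) * ((q - 1#) * u)        ≈⟨ *-congˡ (*-congʳ (⁻¹-anti-homo‿- 1# q)) ⟨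
      (1# - a) * (- (1# - q) * u)      ≈⟨ *-congˡ (-‿distribˡ-* _ _) ⟨
      (1# - a) * (- ((1# - q) * u))    ≈⟨ *-congˡ (-‿cong u-inverse) ⟩
      (1# - a) * (- 1#)                ≈⟨ *-comm _ _ ⟩
      - 1# * (1# - a)                  ≈⟨ -1*x≈-x _ ⟩
      - (1# - a)                       ≈⟨ ⁻¹-anti-homo‿- 1# a ⟩
      a - 1#                           ∎
      where
      a : Carrier
      a = pow q k * x

    lhs : ℕ → ℕ → Carrier
    lhs n k = pow (q - 1#) (n ∸ k) * pow x k * S q u x n k

    lhs-satisfies : SatisfiesRecurrence q x lhs
    lhs-satisfies = record
      { initial-zero = trans (*-identityʳ _) (*-identityʳ 1#)
      ; initial-suc  = λ k → zeroʳ _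
      ; step-zero    = step-zero
      ; step-suc     = step-suc
      }
      where
      open CommutativeMonoidSolver *-commutativeMonoid using (solve; _⊕_; _⊜_; id)
      d : Carrier
      d = q - 1#

      step-zero : ∀ n → lhs (suc n) 0 ≈ (x - 1#) * lhs n 0
      step-zero n = begin
        (d * D) * 1# * (a * A)
          ≈⟨ solve 4 (λ d D a A → ((d ⊕ D) ⊕ id) ⊕ (a ⊕ A) ⊜ (d ⊕ a) ⊕ ((D ⊕ id) ⊕ A))
                     refl d D a A ⟩
        (d * a) * (D * 1# * A)
          ≈⟨ *-congʳ (trans ([q-1]*qshift 0) (+-congʳ (*-identityˡ x))) ⟩
        (x - 1#) * (D * 1# * A)         ≈⟨ *-congˡ (*-congˡ (reflexive (S-zero-column q u x n))) ⟨
        (x - 1#) * lhs n 0              ∎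
        where
        D a A : Carrier
        D = pow d n
        a = qshift q u x 0
        A = pow a n

      step-suc : ∀ n k → lhs (suc n) (suc k) ≈ x * lhs n k + (pow q (suc k) * x - 1#) * lhs n (suc k)
      step-suc n k = begin
        (D * Y) * (S q u x n k + Qs * S′)          ≈⟨ distribˡ _ _ _ ⟩
        (D * Y) * S q u x n k + (D * Y) * (Qs * S′)
          ≈⟨ +-cong (trans (*-congʳ (*-left-comm D x _)) (*-assoc _ _ _)) second ⟩
        x * lhs n k + (pow q (suc k) * x - 1#) * lhs n (suc k) ∎
        where
        D Y Qs S′ D′ : Carrier
        D = pow d (n ∸ k)
        Y = x * pow x k
        Qs = qshift q u x (suc k)
        S′ = S q u x n (suc k)
        D′ = pow d (n ∸ suc k)
        second : (D * Y) * (Qs * S′) ≈ (pow q (suc k) * x - 1#) * lhs n (suc k)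
        second = begin
          (D * Y) * (Qs * S′)
            ≈⟨ solve 4 (λ D Y Qs S′ → (D ⊕ Y) ⊕ (Qs ⊕ S′) ⊜ Y ⊕ (Qs ⊕ (D ⊕ S′))) refl D Y Qs S′ ⟩
          Y * (Qs * (D * S′))          ≈⟨ *-congˡ (*-congˡ (pow-∸-*-S q u x d n k)) ⟩
          Y * (Qs * (d * (D′ * S′)))
            ≈⟨ solve 5 (λ Y Qs d D′ S′ → Y ⊕ (Qs ⊕ (d ⊕ (D′ ⊕ S′))) ⊜ (d ⊕ Qs) ⊕ ((D′ ⊕ Y) ⊕ S′))
                       refl Y Qs d D′ S′ ⟩
          (d * Qs) * (D′ * Y * S′)     ≈⟨ *-congʳ ([q-1]*qshift (suc k)) ⟩
          (pow q (suc k) * x - 1#) * lhs n (suc k) ∎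

mainTheorem4 : ∀ {c ℓ} (R : CommutativeRing c ℓ) →
    let open CommutativeRing R
        open QDefs R
    in (q u x : Carrier) → (1# - q) * u ≈ 1# →
       (n k : ℕ) → k ≤ n →
       pow (q - 1#) (n ∸ k) * pow x k * S q u x n k
         ≈ Σ n (λ i → sgn (n ∸ i) * pow x i * natC (n C i) * qbin q i k)
mainTheorem4 R q u x u-inverse n k _ =
  recurrence-unique (LeftHandSide.lhs-satisfies q u x u-inverse) (RightHandSide.rhs-satisfies q x) n k
  where open QStirling R
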